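{- Let $\mathcal{M}$ be a modal transition system with set of states $S$ and $\phi$ a CTL formula. For every $S_{\mathtt{Sat}}\subseteq S$, we have $\mathrm{val}_c(S_{\mathtt{Sat}})=1$ if and only if $\mathrm{val}_{2t}(S_{\mathtt{Sat}})=1$.
   Context: A modal transition system (MTS) is $\mathcal{M}=(S,AP,\Delta_{may},\Delta_{must},init,\lambda)$ with $S$ finite, $\Delta_{must}\subseteq\Delta_{may}\subseteq S\times S$, $\Delta_{must}(s)\neq\emptyset$ for every $s$, $init\in S$, $\lambda:S\to 2^{AP}$. For $S_{\mathtt{Sat}}\subseteq S$, a pure strategy of $\mathtt{Sat}$ assigns to each $v\in S_{\mathtt{Sat}}$ a set $\sigma(v)$ with $\Delta_{must}(v)\subseteq\sigma(v)\subseteq\Delta_{may}(v)$; pure strategies of $\mathtt{Unsat}$ are defined likewise on $S\setminus S_{\mathtt{Sat}}$. Two pure strategies yield the Kripke structure $\mathcal{K}(\sigma_{\mathtt{Sat}},\sigma_{\mathtt{Unsat}})$ with states $S$, initial state $init$, labeling $\lambda$, transitions from each state given by its owner's strategy; $\rho(\sigma_{\mathtt{Sat}},\sigma_{\mathtt{Unsat}})=1$ if it satisfies $\phi$, else $0$. Two-turn value: $\mathrm{val}_{2t}(S_{\mathtt{Sat}})=1$ if some pure $\sigma_{\mathtt{Sat}}$ gives $\rho=1$ against all pure $\sigma_{\mathtt{Unsat}}$, else $0$. Mixed strategies are probability distributions over pure strategies; $E(p_S,p_U)=\sum_{\sigma,\sigma'}p_S(\sigma)p_U(\sigma')\rho(\sigma,\sigma')$;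 concurrent value $\mathrm{val}_c(S_{\mathtt{Sat}})=\sup_{p_S}\inf_{p_U}E(p_S,p_U)$.
   Formalization: The mixed strategies defining $\mathrm{val}_c(S_{\mathtt{Sat}})$ only assign rational probabilities to pure strategies, instead of arbitrary real values in [0,1]. -}

module Defs where

open import Data.Nat using (ℕ; suc; _<_)
open import Data.Fin using (Fin)
open import Data.Fin.Subset using (Subset; _∈_; _∉_; _⊆_; Nonempty)
open import Data.Vec using (lookup)
open import Data.Bool using (Bool; true; false; if_then_else_)
open import Data.Product using (Σ; ∃; _×_; _,_; proj₁; proj₂)
open import Data.Sum using (_⊎_)
open import Data.Unit using (⊤)
open import Data.List using (List; map; foldr)
open import Data.List.Relation.Unary.All using (All)
open import Relation.Nullary using (¬_)
open import Relation.Binary.PropositionalEquality using (_≡_)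
open import Function.Bundles using (_⇔_)
import Data.Rational as Q
open Q using (ℚ; 0ℚ; 1ℚ)

-- Modal transition systems with state set Fin n and atomic propositions Fin a.
-- Δ_may, Δ_must ⊆ S × S are given as successor-set functions.

record MTS (n a : ℕ) : Set where
  field
    may  : Fin n → Subset n
    must : Fin n → Subset n
    must⊆may      : ∀ s → must s ⊆ may s
    must-nonempty : ∀ s → Nonempty (must s)
    init  : Fin n
    label : Fin n → Subset a
open MTS public

record Kripke (n a : ℕ) : Set where
  field
    trans  : Fin n → Subset n
    kinit  : Fin n
    klabel : Fin n → Subset a
open Kripke public

data CTL (a : ℕ) : Set where
  tt   : CTL a
  atom : Fin a → CTL a
  not  : CTL a → CTL a
  and  : CTL a → CTL a → CTL a
  or   : CTL a → CTL a → CTL a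
  EX AX EF AF EG AG : CTL a → CTL a
  EU AU : CTL a → CTL a → CTL a

Path : ∀ {n a} → Kripke n a → Fin n → Set
Path {n} K s = Σ (ℕ → Fin n) λ π → (π 0 ≡ s) × (∀ i → π (suc i) ∈ trans K (π i))

infix 4 _,_⊨_ _⊨_

_,_⊨_ : ∀ {n a} → Kripke n a → Fin n → CTL a → Set
K , s ⊨ tt = ⊤
K , s ⊨ atom p = p ∈ klabel K s
K , s ⊨ not φ = ¬ (K , s ⊨ φ)
K , s ⊨ and φ ψ = (K , s ⊨ φ) × (K , s ⊨ ψ)
K , s ⊨ or φ ψ = (K , s ⊨ φ) ⊎ (K , s ⊨ ψ)
K , s ⊨ EX φ = ∃ λ t → t ∈ trans K s × (K , t ⊨ φ)
K , s ⊨ AX φ = ∀ t → t ∈ trans K s → K , t ⊨ φ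
K , s ⊨ EF φ = Σ (Path K s) λ p → ∃ λ k → K , proj₁ p k ⊨ φ
K , s ⊨ AF φ = (p : Path K s) → ∃ λ k → K , proj₁ p k ⊨ φ
K , s ⊨ EG φ = Σ (Path K s) λ p → ∀ k → K , proj₁ p k ⊨ φ
K , s ⊨ AG φ = (p : Path K s) → ∀ k → K , proj₁ p k ⊨ φ
K , s ⊨ EU φ ψ = Σ (Path K s) λ p → ∃ λ k →
  (K , proj₁ p k ⊨ ψ) × (∀ i → i < k → K , proj₁ p i ⊨ φ)
K , s ⊨ AU φ ψ = (p : Path K s) → ∃ λ k →
  (K , proj₁ p k ⊨ ψ) × (∀ i → i < k → K , proj₁ p i ⊨ φ)

_⊨_ : ∀ {n a} → Kripke n a → CTL a → Set
K ⊨ φ = K , kinit K ⊨ φ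

-- Pure strategies: a choice σ(v) with must(v) ⊆ σ(v) ⊆ may(v) for each
-- owned state v (values at non-owned states are ignored).

record PureStrat {n a} (M : MTS n a) (owns : Fin n → Set) : Set where
  field
    choice : Fin n → Subset n
    valid  : ∀ v → owns v → (must M v ⊆ choice v) × (choice v ⊆ may M v)
open PureStrat public

SatStrat : ∀ {n a} → MTS n a → Subset n → Set
SatStrat M SSat = PureStrat M (λ v → v ∈ SSat)

UnsatStrat : ∀ {n a} → MTS n a → Subset n → Set
UnsatStrat M SSat = PureStrat M (λ v → v ∉ SSat)

KS : ∀ {n a} (M : MTS n a) (SSat : Subset n) →
     SatStrat M SSat → UnsatStrat M SSat → Kripke n a
KS M SSat σ σ' = record
  { trans  = λ s → if lookup SSat s then choice σ s else choice σ' s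
  ; kinit  = init M
  ; klabel = label M }

RhoSpec : ∀ {n a} (M : MTS n a) (φ : CTL a) (SSat : Subset n) →
          (SatStrat M SSat → UnsatStrat M SSat → Bool) → Set
RhoSpec M φ SSat ρ = ∀ σ σ' → (ρ σ σ' ≡ true) ⇔ (KS M SSat σ σ' ⊨ φ)

Val2t≡1 : ∀ {n a} (M : MTS n a) (SSat : Subset n) →
          (SatStrat M SSat → UnsatStrat M SSat → Bool) → Set
Val2t≡1 M SSat ρ = ∃ λ (σ : SatStrat M SSat) → ∀ (σ' : UnsatStrat M SSat) → ρ σ σ' ≡ true

-- Mixed strategies: (finitely supported) probability distributions with
-- rational weights, given as weighted lists.

weights : {A : Set} → List (ℚ × A) → ℚ
weights = foldr (λ x r → proj₁ x Q.+ r) 0ℚ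

Dist : Set → Set
Dist A = Σ (List (ℚ × A)) λ l → All (λ x → 0ℚ Q.≤ proj₁ x) l × (weights l ≡ 1ℚ)

b2q : Bool → ℚ
b2q true = 1ℚ
b2q false = 0ℚ

Exp : {A B : Set} → (A → B → Bool) → Dist A → Dist B → ℚ
Exp ρ (l , _) (m , _) =
  foldr (λ x r → foldr (λ y r' → (proj₁ x Q.* proj₁ y) Q.* b2q (ρ (proj₂ x) (proj₂ y)) Q.+ r') 0ℚ m Q.+ r) 0ℚ l

-- "sup_{p_S} inf_{p_U} E(p_S,p_U) = v", with sup/inf unfolded via ε:
--   (≤) for every p_S and ε > 0 some p_U gives E ≤ v + ε;
--   (≥) for every ε > 0 some p_S gives E ≥ v - ε against all p_U.
SupInf≡ : {A B : Set} → (A → B → Bool) → ℚ → Set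
SupInf≡ {A} {B} ρ v =
  (∀ (pS : Dist A) (ε : ℚ) → 0ℚ Q.< ε → ∃ λ (pU : Dist B) → Exp ρ pS pU Q.≤ v Q.+ ε)
  × (∀ (ε : ℚ) → 0ℚ Q.< ε → ∃ λ (pS : Dist A) → ∀ (pU : Dist B) → v Q.- ε Q.≤ Exp ρ pS pU)

ValC≡1 : ∀ {n a} (M : MTS n a) (SSat : Subset n) →
         (SatStrat M SSat → UnsatStrat M SSat → Bool) → Set
ValC≡1 M SSat ρ = SupInf≡ ρ 1ℚ

module Submission where

-- Whether K(σ_Sat, σ_Unsat) satisfies φ depends only on each player's choices at the
-- states it owns, and every strategy agrees there with the clamp v ↦ must v ∪ (f v ∩ may v)
-- of some f : Fin n → Subset n; so the pure game is a finite 0/1 matrix game.  Either some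
-- row is all 1, a pure strategy of Sat that also secures 1 in the mixed game, or every row
-- has a 0 among the k columns.  Then the uniform mixture of the columns holds every row,
-- hence every mixed strategy of Sat, to at most 1 − 1/k, so the concurrent value is below 1.

open import Data.Bool using (Bool; true; false; if_then_else_)
open import Data.Bool.Properties using (_≟_; ⇔→≡; ¬-not)
open import Data.Empty using (⊥-elim)
open import Data.Fin using (Fin)
open import Data.Fin.Subset using (Subset; _∈_; _⊆_; _∪_; _∩_)
open import Data.Fin.Subset.Properties using (⊆-antisym; p⊆p∪q; x∈p∪q⁺; x∈p∪q⁻; x∈p∩q⁺; x∈p∩q⁻)
open import Data.List using (List; []; _∷_; map; foldr; length; cartesianProductWith)
open import Data.List.Properties using (foldr-cong)
open import Data.List.Membership.Propositional using () renaming (_∈_ to _∈ₗ_)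
open import Data.List.Membership.Propositional.Properties using (∈-cartesianProductWith⁺)
open import Data.List.Relation.Unary.All using (All; []; _∷_; all?)
import Data.List.Relation.Unary.All as All
open import Data.List.Relation.Unary.All.Properties using (¬Any⇒All¬; ¬All⇒Any¬)
import Data.List.Relation.Unary.All.Properties as All
open import Data.List.Relation.Unary.Any using (Any; here; there; any?)
import Data.List.Relation.Unary.Any as Any
open import Data.List.Relation.Unary.Any.Properties using (map⁺)
open import Data.Nat using (ℕ; zero; suc)
open import Data.Product using (∃; _×_; _,_; proj₁; proj₂; uncurry)
open import Data.Rational
  using (ℚ; 0ℚ; 1ℚ; ½; _+_; _*_; _-_; -_; _≤_; _<_; 1/_; Positive; NonZero; nonNegative; positive)
open import Data.Rational.Properties
  using ( _≤?_; _<?_; ≤-refl; ≤-reflexive; ≤-trans; <⇒≤; <-irrefl; module ≤-Reasoning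
        ; +-assoc; +-identityʳ; *-assoc; *-identityˡ; *-identityʳ; *-zeroˡ; *-zeroʳ
        ; *-distribˡ-+; *-distribʳ-+; *-inverseʳ
        ; +-mono-≤; +-monoˡ-≤; +-monoʳ-≤; +-mono-<-≤; +-monoʳ-<; neg-antimono-≤; neg-antimono-<
        ; *-monoˡ-≤-nonNeg; *-monoˡ-<-pos; positive⁻¹; pos⇒nonZero; 1/pos⇒pos; pos*pos⇒pos)
open import Data.Rational.Solver using (module +-*-Solver)
open +-*-Solver using (solve; _:+_; _:*_; _:-_; _:=_; con)
open import Data.Sum using (_⊎_; inj₁; inj₂; [_,_])
open import Data.Vec using (Vec; []; _∷_; lookup; tabulate)
open import Data.Vec.Properties using (lookup⇒[]=; []=⇒lookup; lookup∘tabulate)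
open import Function using (_∘_; case_of_)
open import Function.Bundles using (_⇔_; mk⇔)
open import Function.Properties.Equivalence using () renaming (sym to ⇔-sym; trans to ⇔-trans)
open import Relation.Binary.PropositionalEquality
  using (_≡_; refl; sym; trans; cong; cong₂; subst; module ≡-Reasoning)
open import Relation.Nullary using (¬_; Dec; yes; no)
open import Relation.Nullary.Decidable using (from-yes)

open import Defs hiding (trans)

private
  variable
    n a : ℕ
    A : Set

record _≈ᴷ_ (K K′ : Kripke n a) : Set where
  field
    trans-≡ : ∀ s → Kripke.trans K s ≡ Kripke.trans K′ s
    label-≡ : ∀ s → klabel K s ≡ klabel K′ s
open _≈ᴷ_

≈ᴷ-sym : {K K′ : Kripke n a} → K ≈ᴷ K′ → K′ ≈ᴷ K
≈ᴷ-sym K≈K′ = record { trans-≡ = sym ∘ trans-≡ K≈K′ ; label-≡ = sym ∘ label-≡ K≈K′ }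

Path-transport : {K K′ : Kripke n a} → K ≈ᴷ K′ → ∀ {s} → Path K s → Path K′ s
Path-transport K≈K′ (π , π₀ , step) =
  π , π₀ , λ i → subst (π (suc i) ∈_) (trans-≡ K≈K′ (π i)) (step i)

⊨-transport : {K K′ : Kripke n a} → K ≈ᴷ K′ → ∀ φ s → K , s ⊨ φ → K′ , s ⊨ φ
⊨-transport K≈K′ tt s h = h
⊨-transport K≈K′ (atom p) s h = subst (p ∈_) (label-≡ K≈K′ s) h
⊨-transport K≈K′ (not φ) s h = h ∘ ⊨-transport (≈ᴷ-sym K≈K′) φ s
⊨-transport K≈K′ (and φ ψ) s (h , h′) = ⊨-transport K≈K′ φ s h , ⊨-transport K≈K′ ψ s h′
⊨-transport K≈K′ (or φ ψ) s (inj₁ h) = inj₁ (⊨-transport K≈K′ φ s h)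
⊨-transport K≈K′ (or φ ψ) s (inj₂ h) = inj₂ (⊨-transport K≈K′ ψ s h)
⊨-transport K≈K′ (EX φ) s (t , t∈ , h) =
  t , subst (t ∈_) (trans-≡ K≈K′ s) t∈ , ⊨-transport K≈K′ φ t h
⊨-transport K≈K′ (AX φ) s h t t∈ =
  ⊨-transport K≈K′ φ t (h t (subst (t ∈_) (sym (trans-≡ K≈K′ s)) t∈))
⊨-transport K≈K′ (EF φ) s (p , k , h) = Path-transport K≈K′ p , k , ⊨-transport K≈K′ φ _ h
⊨-transport K≈K′ (AF φ) s h p with h (Path-transport (≈ᴷ-sym K≈K′) p)
... | k , h′ = k , ⊨-transport K≈K′ φ _ h′
⊨-transport K≈K′ (EG φ) s (p , h) = Path-transport K≈K′ p , λ k → ⊨-transport K≈K′ φ _ (h k)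
⊨-transport K≈K′ (AG φ) s h p k = ⊨-transport K≈K′ φ _ (h (Path-transport (≈ᴷ-sym K≈K′) p) k)
⊨-transport K≈K′ (EU φ ψ) s (p , k , h , before) =
  Path-transport K≈K′ p , k , ⊨-transport K≈K′ ψ _ h ,
  λ i i<k → ⊨-transport K≈K′ φ _ (before i i<k)
⊨-transport K≈K′ (AU φ ψ) s h p with h (Path-transport (≈ᴷ-sym K≈K′) p)
... | k , h′ , before =
  k , ⊨-transport K≈K′ ψ _ h′ , λ i i<k → ⊨-transport K≈K′ φ _ (before i i<k)

allVecs : List A → ∀ n → List (Vec A n)
allVecs xs zero = [] ∷ []
allVecs xs (suc n) = cartesianProductWith _∷_ xs (allVecs xs n)

∈-allVecs : {xs : List A} → (∀ x → x ∈ₗ xs) → (v : Vec A n) → v ∈ₗ allVecs xs n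
∈-allVecs ∈xs [] = here refl
∈-allVecs ∈xs (x ∷ v) = ∈-cartesianProductWith⁺ _∷_ (∈xs x) (∈-allVecs ∈xs v)

allBools : List Bool
allBools = true ∷ false ∷ []

∈-allBools : ∀ b → b ∈ₗ allBools
∈-allBools true = here refl
∈-allBools false = there (here refl)

allSubsets : ∀ n → List (Subset n)
allSubsets = allVecs allBools

p∪[q∩r]≡q : {p q r : Subset n} → p ⊆ q → q ⊆ r → p ∪ (q ∩ r) ≡ q
p∪[q∩r]≡q {p = p} {q} {r} p⊆q q⊆r = ⊆-antisym
  ([ p⊆q , proj₁ ∘ x∈p∩q⁻ q r ] ∘ x∈p∪q⁻ p (q ∩ r))
  (λ x∈q → x∈p∪q⁺ (inj₂ (x∈p∩q⁺ (x∈q , q⊆r x∈q))))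

module Strategies (M : MTS n a) {owns : Fin n → Set} where

  Agree : PureStrat M owns → PureStrat M owns → Set
  Agree σ τ = ∀ v → owns v → choice σ v ≡ choice τ v

  clamp : (Fin n → Subset n) → PureStrat M owns
  clamp f = record
    { choice = λ v → must M v ∪ (f v ∩ may M v)
    ; valid  = λ v _ → p⊆p∪q _ , [ must⊆may M v , proj₂ ∘ x∈p∩q⁻ (f v) (may M v) ] ∘ x∈p∪q⁻ _ _
    }

  strategies : List (PureStrat M owns)
  strategies = map (clamp ∘ lookup) (allVecs (allSubsets n) n)

  strategies-complete : ∀ σ → Any (λ τ → Agree τ σ) strategies
  strategies-complete σ =
    map⁺ (Any.map clamp-tabulate (∈-allVecs (∈-allVecs ∈-allBools) (tabulate (choice σ))))
    where
    clamp-tabulate : ∀ {t} → tabulate (choice σ) ≡ t → Agree (clamp (lookup t)) σ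
    clamp-tabulate refl v owned = begin
      must M v ∪ (lookup (tabulate (choice σ)) v ∩ may M v)
        ≡⟨ cong (λ X → must M v ∪ (X ∩ may M v)) (lookup∘tabulate (choice σ) v) ⟩
      must M v ∪ (choice σ v ∩ may M v)
        ≡⟨ uncurry p∪[q∩r]≡q (valid σ v owned) ⟩
      choice σ v ∎
      where open ≡-Reasoning

module _ (M : MTS n a) (SSat : Subset n) where
  open Strategies M

  KS-cong : {σ τ : SatStrat M SSat} {σ′ τ′ : UnsatStrat M SSat} →
            Agree σ τ → Agree σ′ τ′ → KS M SSat σ σ′ ≈ᴷ KS M SSat τ τ′
  KS-cong {σ} {τ} {σ′} {τ′} σ~τ σ′~τ′ =
    record { trans-≡ = owner-choice-≡ ; label-≡ = λ _ → refl }
    where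
    owner-choice-≡ : ∀ s → (if lookup SSat s then choice σ s else choice σ′ s)
                         ≡ (if lookup SSat s then choice τ s else choice τ′ s)
    owner-choice-≡ s with lookup SSat s in eq
    ... | true  = σ~τ s (lookup⇒[]= s SSat eq)
    ... | false = σ′~τ′ s λ s∈SSat → case subst (_≡ true) eq ([]=⇒lookup s∈SSat) of λ ()

  ρ-cong : ∀ {φ ρ} → RhoSpec M φ SSat ρ →
           {σ τ : SatStrat M SSat} {σ′ τ′ : UnsatStrat M SSat} →
           Agree σ τ → Agree σ′ τ′ → ρ σ σ′ ≡ ρ τ τ′
  ρ-cong {φ} spec {σ} {τ} {σ′} {τ′} σ~τ σ′~τ′ =
    ⇔→≡ (⇔-trans (spec σ σ′) (⇔-trans same-truth (⇔-sym (spec τ τ′))))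
    where
    K≈K′ : KS M SSat σ σ′ ≈ᴷ KS M SSat τ τ′
    K≈K′ = KS-cong {σ} {τ} {σ′} {τ′} σ~τ σ′~τ′
    same-truth : KS M SSat σ σ′ ⊨ φ ⇔ KS M SSat τ τ′ ⊨ φ
    same-truth = mk⇔ (⊨-transport K≈K′ φ (init M)) (⊨-transport (≈ᴷ-sym K≈K′) φ (init M))

NonNegWeights : List (ℚ × A) → Set
NonNegWeights = All (λ x → 0ℚ ≤ proj₁ x)

weightedSum : (A → ℚ) → List (ℚ × A) → ℚ
weightedSum f = foldr (λ x r → proj₁ x * f (proj₂ x) + r) 0ℚ

weightedSum-const : ∀ {f : A → ℚ} {r} → (∀ x → f x ≡ r) → ∀ l → weightedSum f l ≡ weights l * r
weightedSum-const {r = r} f≡r [] = sym (*-zeroˡ r)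
weightedSum-const {f = f} {r} f≡r ((w , x) ∷ l) = begin
  w * f x + weightedSum f l   ≡⟨ cong₂ (λ y z → w * y + z) (f≡r x) (weightedSum-const f≡r l) ⟩
  w * r + weights l * r       ≡⟨ sym (*-distribʳ-+ r w (weights l)) ⟩
  (w + weights l) * r         ∎
  where open ≡-Reasoning

weightedSum-≤-const : ∀ {f : A → ℚ} {r} → (∀ x → f x ≤ r) →
                      ∀ {l} → NonNegWeights l → weightedSum f l ≤ weights l * r
weightedSum-≤-const {r = r} f≤r {[]} [] = ≤-reflexive (sym (*-zeroˡ r))
weightedSum-≤-const {f = f} {r} f≤r {(w , x) ∷ l} (0≤w ∷ nonNeg) = begin
  w * f x + weightedSum f l
    ≤⟨ +-mono-≤ (*-monoˡ-≤-nonNeg w {{nonNegative 0≤w}} (f≤r x)) (weightedSum-≤-const f≤r nonNeg) ⟩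
  w * r + weights l * r       ≡⟨ sym (*-distribʳ-+ r w (weights l)) ⟩
  (w + weights l) * r         ∎
  where open ≤-Reasoning

weightedSum-≤-weights : ∀ {f : A → ℚ} → (∀ x → f x ≤ 1ℚ) →
                        ∀ {l} → NonNegWeights l → weightedSum f l ≤ weights l
weightedSum-≤-weights {f = f} f≤1 {l} nonNeg =
  subst (weightedSum f l ≤_) (*-identityʳ (weights l)) (weightedSum-≤-const f≤1 nonNeg)

expectation-≤ : ∀ {f : A → ℚ} {r} (p : Dist A) → (∀ x → f x ≤ r) → weightedSum f (proj₁ p) ≤ r
expectation-≤ {f = f} {r} (l , nonNeg , total) f≤r = begin
  weightedSum f l  ≤⟨ weightedSum-≤-const f≤r nonNeg ⟩
  weights l * r    ≡⟨ cong (_* r) total ⟩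
  1ℚ * r           ≡⟨ *-identityˡ r ⟩
  r                ∎
  where open ≤-Reasoning

expectation-const : ∀ {f : A → ℚ} {r} (p : Dist A) → (∀ x → f x ≡ r) → weightedSum f (proj₁ p) ≡ r
expectation-const {f = f} {r} (l , _ , total) f≡r = begin
  weightedSum f l  ≡⟨ weightedSum-const f≡r l ⟩
  weights l * r    ≡⟨ cong (_* r) total ⟩
  1ℚ * r           ≡⟨ *-identityˡ r ⟩
  r                ∎
  where open ≡-Reasoning

0≤1 : 0ℚ ≤ 1ℚ
0≤1 = from-yes (0ℚ ≤? 1ℚ)

0<1 : 0ℚ < 1ℚ
0<1 = from-yes (0ℚ <? 1ℚ)

point : A → Dist A
point x = (1ℚ , x) ∷ [] , 0≤1 ∷ [] , +-identityʳ 1ℚ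

fromℕ : ℕ → ℚ
fromℕ zero = 0ℚ
fromℕ (suc k) = 1ℚ + fromℕ k

fromℕ-nonNeg : ∀ k → 0ℚ ≤ fromℕ k
fromℕ-nonNeg zero = ≤-refl
fromℕ-nonNeg (suc k) = +-mono-≤ 0≤1 (fromℕ-nonNeg k)

fromℕ-suc-pos : ∀ k → 0ℚ < fromℕ (suc k)
fromℕ-suc-pos k = +-mono-<-≤ 0<1 (fromℕ-nonNeg k)

constWeights : ℚ → List A → List (ℚ × A)
constWeights δ = map (δ ,_)

constWeights-nonNeg : ∀ {δ} → 0ℚ ≤ δ → (xs : List A) → NonNegWeights (constWeights δ xs)
constWeights-nonNeg 0≤δ xs = All.map⁺ (All.universal (λ _ → 0≤δ) xs)

weights-constWeights : ∀ δ (xs : List A) → weights (constWeights δ xs) ≡ fromℕ (length xs) * δ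
weights-constWeights δ [] = sym (*-zeroˡ δ)
weights-constWeights δ (x ∷ xs) = begin
  δ + weights (constWeights δ xs)   ≡⟨ cong (δ +_) (weights-constWeights δ xs) ⟩
  δ + fromℕ (length xs) * δ         ≡⟨ cong (_+ fromℕ (length xs) * δ) (sym (*-identityˡ δ)) ⟩
  1ℚ * δ + fromℕ (length xs) * δ    ≡⟨ sym (*-distribʳ-+ δ 1ℚ (fromℕ (length xs))) ⟩
  fromℕ (length (x ∷ xs)) * δ       ∎
  where open ≡-Reasoning

module Uniform (x : A) (xs : List A) where

  private
    size : ℚ
    size = fromℕ (length (x ∷ xs))

    instance
      size-positive : Positive size
      size-positive = positive (fromℕ-suc-pos (length xs))

      size-nonZero : NonZero size
      size-nonZero = pos⇒nonZero size

  δ : ℚ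
  δ = 1/ size

  instance
    δ-positive : Positive δ
    δ-positive = 1/pos⇒pos size

  0<δ : 0ℚ < δ
  0<δ = positive⁻¹ δ

  uniform : Dist A
  uniform = constWeights δ (x ∷ xs) , constWeights-nonNeg (<⇒≤ 0<δ) (x ∷ xs) , total
    where
    total : weights (constWeights δ (x ∷ xs)) ≡ 1ℚ
    total = begin
      weights (constWeights δ (x ∷ xs))  ≡⟨ weights-constWeights δ (x ∷ xs) ⟩
      size * δ                           ≡⟨ *-inverseʳ size ⟩
      1ℚ                                 ∎
      where open ≡-Reasoning

weightedSum-constWeights-miss : ∀ {f : A → ℚ} {δ} → 0ℚ ≤ δ → (∀ x → f x ≤ 1ℚ) →
  ∀ {xs} → Any (λ x → f x ≡ 0ℚ) xs →
  weightedSum f (constWeights δ xs) + δ ≤ weights (constWeights δ xs)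
weightedSum-constWeights-miss {f = f} {δ} 0≤δ f≤1 {x ∷ xs} (here fx≡0) = begin
  δ * f x + weightedSum f (constWeights δ xs) + δ
    ≡⟨ cong (λ y → δ * y + weightedSum f (constWeights δ xs) + δ) fx≡0 ⟩
  δ * 0ℚ + weightedSum f (constWeights δ xs) + δ
    ≡⟨ solve 2 (λ d S → d :* con 0ℚ :+ S :+ d := d :+ S) refl δ _ ⟩
  δ + weightedSum f (constWeights δ xs)
    ≤⟨ +-monoʳ-≤ δ (weightedSum-≤-weights f≤1 (constWeights-nonNeg 0≤δ xs)) ⟩
  δ + weights (constWeights δ xs) ∎
  where open ≤-Reasoning
weightedSum-constWeights-miss {f = f} {δ} 0≤δ f≤1 {x ∷ xs} (there miss) = begin
  δ * f x + weightedSum f (constWeights δ xs) + δ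
    ≡⟨ +-assoc (δ * f x) (weightedSum f (constWeights δ xs)) δ ⟩
  δ * f x + (weightedSum f (constWeights δ xs) + δ)
    ≤⟨ +-mono-≤ δfx≤δ (weightedSum-constWeights-miss 0≤δ f≤1 miss) ⟩
  δ + weights (constWeights δ xs) ∎
  where
  open ≤-Reasoning
  δfx≤δ : δ * f x ≤ δ
  δfx≤δ = subst (δ * f x ≤_) (*-identityʳ δ) (*-monoˡ-≤-nonNeg δ {{nonNegative 0≤δ}} (f≤1 x))

weightedSum-point : ∀ (f : A → ℚ) x → weightedSum f (proj₁ (point x)) ≡ f x
weightedSum-point f x = trans (+-identityʳ (1ℚ * f x)) (*-identityˡ (f x))

Dist-inhabitant : Dist A → A
Dist-inhabitant ((_ , x) ∷ _ , _) = x
Dist-inhabitant ([] , _ , ())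

b2q≤1 : ∀ b → b2q b ≤ 1ℚ
b2q≤1 true = ≤-refl
b2q≤1 false = 0≤1

p+q≤r⇒p≤r-q : ∀ {p q r} → p + q ≤ r → p ≤ r - q
p+q≤r⇒p≤r-q {p} {q} {r} p+q≤r = begin
  p          ≡⟨ solve 2 (λ p q → p := p :+ q :- q) refl p q ⟩
  p + q - q  ≤⟨ +-monoˡ-≤ (- q) p+q≤r ⟩
  r - q      ∎
  where open ≤-Reasoning

module ZeroOneGame {A B : Set} (ρ : A → B → Bool) where

  Winning : A → Set
  Winning σ = ∀ τ → ρ σ τ ≡ true

  Refutes : List B → Set
  Refutes τs = ∀ σ → Any (λ τ → ρ σ τ ≡ false) τs

  beats-all? : ∀ τs σ → Dec (All (λ τ → ρ σ τ ≡ true) τs)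
  beats-all? τs σ = all? (λ τ → ρ σ τ ≟ true) τs

  winning-or-refuted : {σs : List A} {τs : List B} →
                       (∀ σ → Any (λ σ₀ → ∀ τ → ρ σ₀ τ ≡ ρ σ τ) σs) →
                       (∀ τ → Any (λ τ₀ → ∀ σ → ρ σ τ₀ ≡ ρ σ τ) τs) →
                       ∃ Winning ⊎ Refutes τs
  winning-or-refuted {σs} {τs} rows columns with any? (beats-all? τs) σs
  ... | yes some-beats-all =
    let σ₀ , beats-all = Any.satisfied some-beats-all
        wins τ = let beats , same = All.lookupAny beats-all (columns τ)
                 in trans (sym (same σ₀)) beats
    in inj₁ (σ₀ , wins)
  ... | no none-beats-all = inj₂ λ σ →
    let ¬beats-all , same = All.lookupAny (¬Any⇒All¬ σs none-beats-all) (rows σ)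
    in Any.map (λ {τ} ρ≢true → trans (sym (same τ)) (¬-not ρ≢true))
               (¬All⇒Any¬ (λ τ → _ ≟ true) τs ¬beats-all)

  payoff : A → List (ℚ × B) → ℚ
  payoff σ = weightedSum (b2q ∘ ρ σ)

  Exp≡weightedSum-payoff : (pS : Dist A) (pU : Dist B) →
                           Exp ρ pS pU ≡ weightedSum (λ σ → payoff σ (proj₁ pU)) (proj₁ pS)
  Exp≡weightedSum-payoff (l , _) (m , _) =
    foldr-cong (λ x r → cong (_+ r) (scaled-payoff (proj₁ x) (proj₂ x) m)) refl l
    where
    scaled-payoff : ∀ c σ m →
                    foldr (λ y r → (c * proj₁ y) * b2q (ρ σ (proj₂ y)) + r) 0ℚ m ≡ c * payoff σ m
    scaled-payoff c σ [] = sym (*-zeroʳ c)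
    scaled-payoff c σ ((w , τ) ∷ m) = begin
      c * w * b2q (ρ σ τ) + _                  ≡⟨ cong₂ _+_ (*-assoc c w (b2q (ρ σ τ)))
                                                            (scaled-payoff c σ m) ⟩
      c * (w * b2q (ρ σ τ)) + c * payoff σ m   ≡⟨ sym (*-distribˡ-+ c _ (payoff σ m)) ⟩
      c * payoff σ ((w , τ) ∷ m)               ∎
      where open ≡-Reasoning

  Exp≤1 : ∀ pS pU → Exp ρ pS pU ≤ 1ℚ
  Exp≤1 pS pU = subst (_≤ 1ℚ) (sym (Exp≡weightedSum-payoff pS pU))
    (expectation-≤ pS λ σ → expectation-≤ pU (b2q≤1 ∘ ρ σ))

  winning⇒value1 : B → ∀ {σ} → Winning σ → SupInf≡ ρ 1ℚ
  winning⇒value1 τ₀ {σ} wins = upper , lower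
    where
    upper : ∀ pS ε → 0ℚ < ε → ∃ λ pU → Exp ρ pS pU ≤ 1ℚ + ε
    upper pS ε 0<ε = point τ₀ , ≤-trans (Exp≤1 pS (point τ₀)) (+-monoʳ-≤ 1ℚ (<⇒≤ 0<ε))
    lower : ∀ ε → 0ℚ < ε → ∃ λ pS → ∀ pU → 1ℚ - ε ≤ Exp ρ pS pU
    lower ε 0<ε = point σ , λ pU → begin
      1ℚ - ε
        ≤⟨ +-monoʳ-≤ 1ℚ (neg-antimono-≤ (<⇒≤ 0<ε)) ⟩
      1ℚ
        ≡⟨ sym (expectation-const pU (cong b2q ∘ wins)) ⟩
      payoff σ (proj₁ pU)
        ≡⟨ sym (weightedSum-point (λ σ′ → payoff σ′ (proj₁ pU)) σ) ⟩
      weightedSum (λ σ′ → payoff σ′ (proj₁ pU)) (proj₁ (point σ))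
        ≡⟨ sym (Exp≡weightedSum-payoff (point σ) pU) ⟩
      Exp ρ (point σ) pU ∎
      where open ≤-Reasoning

  refuted⇒¬value1 : ∀ τs → Refutes τs → ¬ SupInf≡ ρ 1ℚ
  refuted⇒¬value1 [] refutes (_ , lower) with () ← refutes (Dist-inhabitant (proj₁ (lower 1ℚ 0<1)))
  refuted⇒¬value1 (τ ∷ τs) refutes (_ , lower) = <-irrefl refl (begin-strict
    1ℚ - δ                                                    <⟨ +-monoʳ-< 1ℚ (neg-antimono-< ε<δ) ⟩
    1ℚ - ε                                                    ≤⟨ proj₂ (lower ε 0<ε) uniform ⟩
    Exp ρ pS uniform                                          ≡⟨ Exp≡weightedSum-payoff pS uniform ⟩
    weightedSum (λ σ → payoff σ (proj₁ uniform)) (proj₁ pS)  ≤⟨ expectation-≤ pS payoff≤1-δ ⟩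
    1ℚ - δ                                                    ∎)
    where
    open Uniform τ τs
    open ≤-Reasoning
    ε : ℚ
    ε = ½ * δ
    0<ε : 0ℚ < ε
    0<ε = positive⁻¹ ε {{pos*pos⇒pos ½ δ}}
    ε<δ : ε < δ
    ε<δ = subst (ε <_) (*-identityˡ δ) (*-monoˡ-<-pos δ (from-yes (½ <? 1ℚ)))
    pS : Dist A
    pS = proj₁ (lower ε 0<ε)
    payoff≤1-δ : ∀ σ → payoff σ (proj₁ uniform) ≤ 1ℚ - δ
    payoff≤1-δ σ = p+q≤r⇒p≤r-q (subst (payoff σ (proj₁ uniform) + δ ≤_) (proj₂ (proj₂ uniform))
      (weightedSum-constWeights-miss (<⇒≤ 0<δ) (b2q≤1 ∘ ρ σ) (Any.map (cong b2q) (refutes σ))))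

mainTheorem16 : ∀ {n a : ℕ} (M : MTS n a) (φ : CTL a) (SSat : Subset n)
    (ρ : SatStrat M SSat → UnsatStrat M SSat → Bool) → RhoSpec M φ SSat ρ →
    ValC≡1 M SSat ρ ⇔ Val2t≡1 M SSat ρ
mainTheorem16 M φ SSat ρ spec =
  mk⇔ value1⇒winning (λ (_ , wins) → winning⇒value1 (clamp (may M)) wins)
  where
  open Strategies M
  open ZeroOneGame ρ

  rows : ∀ σ → Any (λ σ₀ → ∀ τ → ρ σ₀ τ ≡ ρ σ τ) strategies
  rows σ = Any.map (λ σ₀~σ τ → ρ-cong M SSat spec σ₀~σ (λ _ _ → refl)) (strategies-complete σ)

  columns : ∀ τ → Any (λ τ₀ → ∀ σ → ρ σ τ₀ ≡ ρ σ τ) strategies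
  columns τ = Any.map (λ τ₀~τ σ → ρ-cong M SSat spec (λ _ _ → refl) τ₀~τ) (strategies-complete τ)

  value1⇒winning : ValC≡1 M SSat ρ → Val2t≡1 M SSat ρ
  value1⇒winning value1 with winning-or-refuted rows columns
  ... | inj₁ winner = winner
  ... | inj₂ refutes = ⊥-elim (refuted⇒¬value1 strategies refutes value1)
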